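{- Assume $\Delta<0$. Let $P=(x,y)\in\mathcal C(\mathbb Q)$ and write $x=r/n$, $y=s/n$ with integers $r,s,n$, $n>0$, $\gcd(r,n)=\gcd(s,n)=1$. Then the canonical height of $P$ is $h(P)=\log n$.
   Context: Let $d$ be a squarefree integer with $d\neq 1$, and put $\Delta=d$ if $d\equiv 1\pmod 4$ and $\Delta=4d$ if $d\equiv 2,3\pmod 4$. Let $\mathcal C(\mathbb Q)=\{(x,y)\in\mathbb Q^2: x^2-\Delta y^2=4\}$, an abelian group with neutral element $(2,0)$ and addition $(r,s)+(t,u)=\big(\frac{rt+\Delta su}{2},\frac{ru+st}{2}\big)$. Every $(x,y)\in\mathcal C(\mathbb Q)$ can be written as $x=r/n$, $y=s/n$ with $\gcd(r,n)=\gcd(s,n)=1$. For $x=r/s\in\mathbb Q$ in lowest terms let $H(x)=\max\{|r|,|s|\}$; for $P=(x,y)$ let $h_0(P)=\log H(x)$, and define the canonical height $h(P)=\lim_{n\to\infty}2^{ -n}h_0(2^nP)$ (this limit exists). -}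

module Defs where

open import Data.Nat as ℕ using (ℕ; zero; suc)
open import Data.Nat.Divisibility as ℕD using ()
open import Data.Integer as ℤ using (ℤ; +_)
open import Data.Integer.DivMod using (_%_)
open import Data.Rational as ℚ using (ℚ; _/_; ↥_; ↧ₙ_; _*_; _+_)
open import Data.Product using (_×_; _,_; proj₁)
open import Relation.Binary.PropositionalEquality using (_≡_)

SquareFree : ℤ → Set
SquareFree d = (m : ℕ) → (m ℕ.* m) ℕD.∣ ℤ.∣ d ∣ → m ≡ 1

Δ : ℤ → ℤ
Δ d with d % (+ 4)
... | 1 = d
... | _ = + 4 ℤ.* d

⟦_⟧ : ℤ → ℚ
⟦ z ⟧ = z / 1

_^ℚ_ : ℚ → ℕ → ℚ
q ^ℚ zero = ℚ.1ℚ
q ^ℚ suc k = q * (q ^ℚ k)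

half : ℚ
half = + 1 / 2

addC : ℤ → ℚ × ℚ → ℚ × ℚ → ℚ × ℚ
addC D (r , s) (t , u) = (half * (r * t + ⟦ D ⟧ * (s * u)) , half * (r * u + s * t))

pow2C : ℤ → ℕ → ℚ × ℚ → ℚ × ℚ
pow2C D zero P = P
pow2C D (suc k) P = let Q = pow2C D k P in addC D Q Q

H : ℚ → ℕ
H x = ℤ.∣ ↥ x ∣ ℕ.⊔ ↧ₙ x

{-# OPTIONS --safe #-}
-- For Δ < 0 the curve x² − Δy² = 4 is bounded, |x| ≤ 2, and doubling acts on the
-- x-coordinate as x ↦ x² − 2. If x = a/N in lowest terms then x² − 2 = (a² − 2N²)/N²
-- is again in lowest terms, since a common prime factor of N and a² − 2N² would divide a.
-- Hence x(2ᵏP) has denominator n^(2^k) and numerator of absolute value at most twice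
-- that, so n^(2^k) ≤ H(x(2ᵏP)) ≤ 2·n^(2^k), and the factor 2 disappears in the limit
-- because 2 ≤ (1 + δ)^(2^k) for large k.
module Submission where

open import Defs
open import Data.Nat as ℕ using (ℕ; _≥_; _^_)
open import Data.Nat.GCD using (gcd)
open import Data.Integer as ℤ using (ℤ; +_)
open import Data.Rational as ℚ using (ℚ; _/_; _*_; _+_; _-_; _≤_; _<_)
open import Data.Product using (_×_; _,_; proj₁; ∃)
open import Relation.Binary.PropositionalEquality using (_≡_; _≢_)

open import Data.Nat using (zero; suc)
import Data.Nat.Properties as ℕP
open import Data.Nat.Coprimality as ℕC using (Coprime)
import Data.Nat.Divisibility as ℕD
import Data.Nat.Solver as ℕSolver
import Data.Integer.Properties as ℤP
import Data.Integer.Divisibility.Signed as ℤD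
open import Data.Rational using (↥_; ↧_; ↧ₙ_; toℚᵘ; 0ℚ; 1ℚ)
import Data.Rational.Properties as ℚP
open import Data.Rational.Unnormalised as ℚᵘ using (mkℚᵘ; *≡*; *≤*)
import Data.Rational.Unnormalised.Properties as ℚᵘP
import Data.Rational.Solver as ℚSolver
open import Data.Sum using (inj₁; inj₂)
open import Relation.Binary.PropositionalEquality
  using (refl; sym; trans; cong; cong₂; subst; module ≡-Reasoning)

toℚᵘ-/ : ∀ i n .{{_ : ℕ.NonZero n}} → toℚᵘ (i / n) ℚᵘ.≃ (i ℚᵘ./ n)
toℚᵘ-/ i (suc n) = ℚP.toℚᵘ-fromℚᵘ (mkℚᵘ i n)

/-*-/ : ∀ i j m n .{{_ : ℕ.NonZero m}} .{{_ : ℕ.NonZero n}} →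
        (i / m) * (j / n) ≡ _/_ (i ℤ.* j) (m ℕ.* n) {{ℕP.m*n≢0 m n}}
/-*-/ i j m@(suc _) n@(suc _) = ℚP.toℚᵘ-injective (begin
  toℚᵘ ((i / m) * (j / n))        ≈⟨ ℚP.toℚᵘ-homo-* (i / m) (j / n) ⟩
  toℚᵘ (i / m) ℚᵘ.* toℚᵘ (j / n)  ≈⟨ ℚᵘP.*-cong (toℚᵘ-/ i m) (toℚᵘ-/ j n) ⟩
  (i ℚᵘ./ m) ℚᵘ.* (j ℚᵘ./ n)      ≈⟨ toℚᵘ-/ (i ℤ.* j) (m ℕ.* n) ⟨
  toℚᵘ ((i ℤ.* j) / (m ℕ.* n))    ∎)
  where open ℚᵘP.≃-Reasoning

/-+-/ : ∀ i j m n .{{_ : ℕ.NonZero m}} .{{_ : ℕ.NonZero n}} →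
        (i / m) + (j / n) ≡ _/_ (i ℤ.* + n ℤ.+ j ℤ.* + m) (m ℕ.* n) {{ℕP.m*n≢0 m n}}
/-+-/ i j m@(suc _) n@(suc _) = ℚP.toℚᵘ-injective (begin
  toℚᵘ ((i / m) + (j / n))                  ≈⟨ ℚP.toℚᵘ-homo-+ (i / m) (j / n) ⟩
  toℚᵘ (i / m) ℚᵘ.+ toℚᵘ (j / n)            ≈⟨ ℚᵘP.+-cong (toℚᵘ-/ i m) (toℚᵘ-/ j n) ⟩
  (i ℚᵘ./ m) ℚᵘ.+ (j ℚᵘ./ n)                ≈⟨ toℚᵘ-/ (i ℤ.* + n ℤ.+ j ℤ.* + m) (m ℕ.* n) ⟨
  toℚᵘ ((i ℤ.* + n ℤ.+ j ℤ.* + m) / (m ℕ.* n)) ∎)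
  where open ℚᵘP.≃-Reasoning

*≡*⇒/≡/ : ∀ i j m n .{{_ : ℕ.NonZero m}} .{{_ : ℕ.NonZero n}} →
          i ℤ.* + n ≡ j ℤ.* + m → i / m ≡ j / n
*≡*⇒/≡/ i j m@(suc _) n@(suc _) eq = ℚP.toℚᵘ-injective
  (ℚᵘP.≃-trans (toℚᵘ-/ i m) (ℚᵘP.≃-trans (*≡* eq) (ℚᵘP.≃-sym (toℚᵘ-/ j n))))

*≤*⇒/≤/ : ∀ i j m n .{{_ : ℕ.NonZero m}} .{{_ : ℕ.NonZero n}} →
          i ℤ.* + n ℤ.≤ j ℤ.* + m → i / m ≤ j / n
*≤*⇒/≤/ i j m@(suc _) n@(suc _) le = ℚP.toℚᵘ-cancel-≤
  (ℚᵘP.≤-respˡ-≃ (ℚᵘP.≃-sym (toℚᵘ-/ i m)) (ℚᵘP.≤-respʳ-≃ (ℚᵘP.≃-sym (toℚᵘ-/ j n)) (*≤* le)))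

/≤/⇒*≤* : ∀ i j m n .{{_ : ℕ.NonZero m}} .{{_ : ℕ.NonZero n}} →
          i / m ≤ j / n → i ℤ.* + n ℤ.≤ j ℤ.* + m
/≤/⇒*≤* i j m@(suc _) n@(suc _) le
  with ℚᵘP.≤-respˡ-≃ (toℚᵘ-/ i m) (ℚᵘP.≤-respʳ-≃ (toℚᵘ-/ j n) (ℚP.toℚᵘ-mono-≤ le))
... | *≤* le′ = le′

↧ₙ-/ : ∀ i n .{{_ : ℕ.NonZero n}} → Coprime ℤ.∣ i ∣ n → ↧ₙ (i / n) ≡ n
↧ₙ-/ i n coprime = ℤP.+-injective (begin
  ↧ (i / n)                         ≡⟨ ℤP.*-identityʳ (↧ (i / n)) ⟨
  ↧ (i / n) ℤ.* + 1                 ≡⟨ cong (λ g → ↧ (i / n) ℤ.* + g) (ℕC.coprime⇒gcd≡1 coprime) ⟨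
  ↧ (i / n) ℤ.* + gcd ℤ.∣ i ∣ n     ≡⟨ ℚP.↧-/ i n ⟩
  + n                               ∎)
  where open ≡-Reasoning

⟦⟧-+ : ∀ i j → ⟦ i ℤ.+ j ⟧ ≡ ⟦ i ⟧ + ⟦ j ⟧
⟦⟧-+ i j = sym (trans (/-+-/ i j 1 1) (ℚP./-cong (cong₂ ℤ._+_ (ℤP.*-identityʳ i) (ℤP.*-identityʳ j)) refl))

⟦⟧-* : ∀ i j → ⟦ i ℤ.* j ⟧ ≡ ⟦ i ⟧ * ⟦ j ⟧
⟦⟧-* i j = sym (/-*-/ i j 1 1)

⟦⟧-mono-≤ : ∀ {i j} → i ℤ.≤ j → ⟦ i ⟧ ≤ ⟦ j ⟧
⟦⟧-mono-≤ {i} {j} le = *≤*⇒/≤/ i j 1 1 (ℤP.*-monoʳ-≤-nonNeg (+ 1) le)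

⟦↧p⟧*p≡⟦↥p⟧ : ∀ p → ⟦ ↧ p ⟧ * p ≡ ⟦ ↥ p ⟧
⟦↧p⟧*p≡⟦↥p⟧ p = begin
  ⟦ ↧ p ⟧ * p                   ≡⟨ cong (⟦ ↧ p ⟧ *_) (ℚP.↥p/↧p≡p p) ⟨
  ⟦ ↧ p ⟧ * (↥ p / ↧ₙ p)        ≡⟨ /-*-/ (↧ p) (↥ p) 1 (↧ₙ p) ⟩
  (↧ p ℤ.* ↥ p) / (1 ℕ.* ↧ₙ p)  ≡⟨ *≡*⇒/≡/ (↧ p ℤ.* ↥ p) (↥ p) (1 ℕ.* ↧ₙ p) 1 cross ⟩
  ⟦ ↥ p ⟧                       ∎
  where
  open ≡-Reasoning
  cross : ↧ p ℤ.* ↥ p ℤ.* + 1 ≡ ↥ p ℤ.* + (1 ℕ.* ↧ₙ p)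
  cross = trans (ℤP.*-identityʳ _)
    (trans (ℤP.*-comm (↧ p) (↥ p)) (cong (λ m → ↥ p ℤ.* + m) (sym (ℕP.*-identityˡ (↧ₙ p)))))

coprime-*ʳ : ∀ {m n o} → Coprime m n → Coprime m o → Coprime m (n ℕ.* o)
coprime-*ʳ m⊥n m⊥o (d∣m , d∣no) =
  m⊥o (d∣m , ℕC.coprime-divisor (λ (e∣d , e∣n) → m⊥n (ℕD.∣-trans e∣d d∣m , e∣n)) d∣no)

coprime-*-self : ∀ {m n} → Coprime m n → Coprime (m ℕ.* m) (n ℕ.* n)
coprime-*-self {m} {n} m⊥n = ℕC.sym (coprime-*ʳ nn⊥m nn⊥m)
  where
  nn⊥m : Coprime (n ℕ.* n) m
  nn⊥m = ℕC.sym (coprime-*ʳ m⊥n m⊥n)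

coprime-sub-multiple : ∀ i k n → Coprime ℤ.∣ i ∣ n → Coprime ℤ.∣ i ℤ.- k ℤ.* + n ∣ n
coprime-sub-multiple i k n i⊥n {d} (d∣i-kn , d∣n) = i⊥n (ℤD.∣⇒∣ᵤ d∣i , d∣n)
  where
  d∣i : + d ℤD.∣ i
  d∣i = ℤD.∣m+n∣n⇒∣m (ℤD.∣ᵤ⇒∣ {+ d} {i ℤ.- k ℤ.* + n} d∣i-kn)
                     (ℤD.∣m⇒∣-m (ℤD.∣n⇒∣m*n k (ℤD.∣ᵤ⇒∣ {+ d} {+ n} d∣n)))

↧ₙ[p*p-2] : ∀ p → ↧ₙ (p * p - ⟦ + 2 ⟧) ≡ ↧ₙ p ℕ.* ↧ₙ p
↧ₙ[p*p-2] p@(ℚ.mkℚ _ _ a⊥N) = trans (cong ↧ₙ_ p*p-2≡a′/N²) (↧ₙ-/ a′ (N ℕ.* N) a′⊥N²)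
  where
  a : ℤ
  a = ↥ p
  N : ℕ
  N = ↧ₙ p
  a′ : ℤ
  a′ = a ℤ.* a ℤ.- + 2 ℤ.* + (N ℕ.* N)
  p*p-2≡a′/N² : p * p - ⟦ + 2 ⟧ ≡ a′ / (N ℕ.* N)
  -- The second step is definitional: p - q is p + - q, and - ⟦ + 2 ⟧ is a closed term.
  p*p-2≡a′/N² = begin
    p * p - ⟦ + 2 ⟧                    ≡⟨ cong (λ q → q * q - ⟦ + 2 ⟧) (ℚP.↥p/↧p≡p p) ⟨
    (a / N) * (a / N) + ⟦ ℤ.- + 2 ⟧    ≡⟨ cong (_+ ⟦ ℤ.- + 2 ⟧) (/-*-/ a a N N) ⟩
    (a ℤ.* a) / (N ℕ.* N) + ⟦ ℤ.- + 2 ⟧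
      ≡⟨ /-+-/ (a ℤ.* a) (ℤ.- + 2) (N ℕ.* N) 1 ⟩
    (a ℤ.* a ℤ.* + 1 ℤ.+ ℤ.- + 2 ℤ.* + (N ℕ.* N)) / (N ℕ.* N ℕ.* 1)
      ≡⟨ ℚP./-cong (cong₂ ℤ._+_ (ℤP.*-identityʳ (a ℤ.* a))
                              (sym (ℤP.neg-distribˡ-* (+ 2) (+ (N ℕ.* N)))))
                   (ℕP.*-identityʳ (N ℕ.* N)) ⟩
    a′ / (N ℕ.* N)                     ∎
    where open ≡-Reasoning
  a′⊥N² : Coprime ℤ.∣ a′ ∣ (N ℕ.* N)
  a′⊥N² = coprime-sub-multiple (a ℤ.* a) (+ 2) (N ℕ.* N)
    (subst (λ m → Coprime m (N ℕ.* N)) (sym (ℤP.abs-* a a))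
      (coprime-*-self (ℕC.recompute a⊥N)))

i*i≡+∣i∣*∣i∣ : ∀ i → i ℤ.* i ≡ + (ℤ.∣ i ∣ ℕ.* ℤ.∣ i ∣)
i*i≡+∣i∣*∣i∣ (+ m)     = sym (ℤP.pos-* m m)
i*i≡+∣i∣*∣i∣ ℤ.-[1+ m ] = refl

m*m≤n*n⇒m≤n : ∀ {m n} → m ℕ.* m ℕ.≤ n ℕ.* n → m ℕ.≤ n
m*m≤n*n⇒m≤n m*m≤n*n = ℕP.≮⇒≥ (λ n<m → ℕP.<⇒≱ (ℕP.*-mono-< n<m n<m) m*m≤n*n)

∣↥p∣≤2↧ₙp : ∀ p → p * p ≤ ⟦ + 4 ⟧ → ℤ.∣ ↥ p ∣ ℕ.≤ 2 ℕ.* ↧ₙ p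
∣↥p∣≤2↧ₙp p p*p≤4 = m*m≤n*n⇒m≤n (ℤP.drop‿+≤+ (begin
  + (ℤ.∣ a ∣ ℕ.* ℤ.∣ a ∣)   ≡⟨ i*i≡+∣i∣*∣i∣ a ⟨
  a ℤ.* a                   ≡⟨ ℤP.*-identityʳ (a ℤ.* a) ⟨
  a ℤ.* a ℤ.* + 1           ≤⟨ /≤/⇒*≤* (a ℤ.* a) (+ 4) (N ℕ.* N) 1 a²/N²≤4 ⟩
  + 4 ℤ.* + (N ℕ.* N)       ≡⟨ ℤP.pos-* 4 (N ℕ.* N) ⟨
  + (4 ℕ.* (N ℕ.* N))       ≡⟨ cong +_ (solve 1 (λ N → con 4 :* (N :* N) := (con 2 :* N) :* (con 2 :* N))
                                                refl N) ⟩
  + (2 ℕ.* N ℕ.* (2 ℕ.* N)) ∎))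
  where
  open ℤP.≤-Reasoning
  open ℕSolver.+-*-Solver using (solve; con; _:*_; _:=_)
  a : ℤ
  a = ↥ p
  N : ℕ
  N = ↧ₙ p
  a²/N²≤4 : (a ℤ.* a) / (N ℕ.* N) ≤ ⟦ + 4 ⟧
  a²/N²≤4 = subst (_≤ ⟦ + 4 ⟧)
    (trans (cong (λ q → q * q) (sym (ℚP.↥p/↧p≡p p))) (/-*-/ a a N N)) p*p≤4

H≤2↧ₙ : ∀ p → p * p ≤ ⟦ + 4 ⟧ → H p ℕ.≤ 2 ℕ.* ↧ₙ p
H≤2↧ₙ p p*p≤4 = ℕP.⊔-lub (∣↥p∣≤2↧ₙp p p*p≤4) (ℕP.m≤n*m (↧ₙ p) 2)

OnCurve : ℤ → ℚ × ℚ → Set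
OnCurve D (x , y) = x * x - ⟦ D ⟧ * (y * y) ≡ ⟦ + 4 ⟧

addC-onCurve : ∀ D {P Q} → OnCurve D P → OnCurve D Q → OnCurve D (addC D P Q)
addC-onCurve D {r , s} {t , u} P∈C Q∈C = begin
  (half * (r * t + Δ′ * (s * u))) * (half * (r * t + Δ′ * (s * u)))
    - Δ′ * ((half * (r * u + s * t)) * (half * (r * u + s * t)))
    ≡⟨ brahmagupta Δ′ r s t u ⟩
  (half * half) * ((r * r - Δ′ * (s * s)) * (t * t - Δ′ * (u * u)))
    ≡⟨ cong₂ (λ a b → (half * half) * (a * b)) P∈C Q∈C ⟩
  (half * half) * (⟦ + 4 ⟧ * ⟦ + 4 ⟧)
    ≡⟨⟩
  ⟦ + 4 ⟧ ∎
  where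
  open ≡-Reasoning
  open ℚSolver.+-*-Solver using (solve; con; _:+_; _:-_; _:*_; _:=_)
  Δ′ : ℚ
  Δ′ = ⟦ D ⟧
  brahmagupta : ∀ D r s t u →
    (half * (r * t + D * (s * u))) * (half * (r * t + D * (s * u)))
      - D * ((half * (r * u + s * t)) * (half * (r * u + s * t)))
    ≡ (half * half) * ((r * r - D * (s * s)) * (t * t - D * (u * u)))
  brahmagupta = solve 5 (λ D r s t u →
      (con half :* (r :* t :+ D :* (s :* u))) :* (con half :* (r :* t :+ D :* (s :* u)))
        :- D :* ((con half :* (r :* u :+ s :* t)) :* (con half :* (r :* u :+ s :* t)))
      := (con half :* con half) :* ((r :* r :- D :* (s :* s)) :* (t :* t :- D :* (u :* u))))
    refl

proj₁-addC-self : ∀ D {P} → OnCurve D P → proj₁ (addC D P P) ≡ proj₁ P * proj₁ P - ⟦ + 2 ⟧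
proj₁-addC-self D {x , y} P∈C = begin
  half * (x * x + ⟦ D ⟧ * (y * y))          ≡⟨ rearrange ⟦ D ⟧ x y ⟩
  x * x - half * (x * x - ⟦ D ⟧ * (y * y))  ≡⟨ cong (λ c → x * x - half * c) P∈C ⟩
  x * x - half * ⟦ + 4 ⟧                    ≡⟨⟩
  x * x - ⟦ + 2 ⟧                           ∎
  where
  open ≡-Reasoning
  open ℚSolver.+-*-Solver using (solve; con; _:+_; _:-_; _:*_; _:=_)
  rearrange : ∀ D x y → half * (x * x + D * (y * y)) ≡ x * x - half * (x * x - D * (y * y))
  rearrange = solve 3 (λ D x y →
    con half :* (x :* x :+ D :* (y :* y)) := x :* x :- con half :* (x :* x :- D :* (y :* y))) refl

pow2C-onCurve : ∀ D {P} → OnCurve D P → ∀ k → OnCurve D (pow2C D k P)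
pow2C-onCurve D P∈C zero = P∈C
pow2C-onCurve D {P} P∈C (suc k) = addC-onCurve D {2ᵏP} {2ᵏP} 2ᵏP∈C 2ᵏP∈C
  where
  2ᵏP : ℚ × ℚ
  2ᵏP = pow2C D k P
  2ᵏP∈C : OnCurve D 2ᵏP
  2ᵏP∈C = pow2C-onCurve D {P} P∈C k

↧ₙ-pow2C : ∀ D {P} → OnCurve D P → ∀ k → ↧ₙ (proj₁ (pow2C D k P)) ≡ ↧ₙ (proj₁ P) ^ (2 ^ k)
↧ₙ-pow2C D {P} P∈C zero    = sym (ℕP.*-identityʳ (↧ₙ (proj₁ P)))
↧ₙ-pow2C D {P} P∈C (suc k) = begin
  ↧ₙ (proj₁ (addC D Q Q))             ≡⟨ cong ↧ₙ_ (proj₁-addC-self D {Q} Q∈C) ⟩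
  ↧ₙ (proj₁ Q * proj₁ Q - ⟦ + 2 ⟧)    ≡⟨ ↧ₙ[p*p-2] (proj₁ Q) ⟩
  ↧ₙ (proj₁ Q) ℕ.* ↧ₙ (proj₁ Q)       ≡⟨ cong₂ ℕ._*_ ih ih ⟩
  N ^ m ℕ.* N ^ m                     ≡⟨ ℕP.^-distribˡ-+-* N m m ⟨
  N ^ (m ℕ.+ m)                       ≡⟨ cong (λ e → N ^ (m ℕ.+ e)) (ℕP.+-identityʳ m) ⟨
  N ^ (2 ^ suc k)                     ∎
  where
  open ≡-Reasoning
  Q : ℚ × ℚ
  Q = pow2C D k P
  Q∈C : OnCurve D Q
  Q∈C = pow2C-onCurve D {P} P∈C k
  N m : ℕ
  N = ↧ₙ (proj₁ P)
  m = 2 ^ k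
  ih : ↧ₙ (proj₁ Q) ≡ N ^ m
  ih = ↧ₙ-pow2C D {P} P∈C k

*-self-nonNeg : ∀ p → ℚ.NonNegative (p * p)
*-self-nonNeg p with ℚP.≤-total 0ℚ p
... | inj₁ 0≤p = ℚP.nonNeg*nonNeg⇒nonNeg p {{ℚ.nonNegative 0≤p}} p {{ℚ.nonNegative 0≤p}}
... | inj₂ p≤0 = ℚP.nonPos*nonPos⇒nonPos p {{ℚ.nonPositive p≤0}} p {{ℚ.nonPositive p≤0}}

onCurve⇒x*x≤4 : ∀ {D} → D ℤ.< + 0 → ∀ {P} → OnCurve D P → proj₁ P * proj₁ P ≤ ⟦ + 4 ⟧
onCurve⇒x*x≤4 {D} D<0 {x , y} P∈C = begin
  x * x                                        ≡⟨ rearrange ⟦ D ⟧ x y ⟩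
  (x * x - ⟦ D ⟧ * (y * y)) + ⟦ D ⟧ * (y * y)  ≡⟨ cong (_+ ⟦ D ⟧ * (y * y)) P∈C ⟩
  ⟦ + 4 ⟧ + ⟦ D ⟧ * (y * y)                    ≤⟨ ℚP.+-monoʳ-≤ ⟦ + 4 ⟧ Dy²≤0 ⟩
  ⟦ + 4 ⟧ + 0ℚ                                 ≡⟨ ℚP.+-identityʳ ⟦ + 4 ⟧ ⟩
  ⟦ + 4 ⟧                                      ∎
  where
  open ℚP.≤-Reasoning
  open ℚSolver.+-*-Solver using (solve; _:+_; _:-_; _:*_; _:=_)
  rearrange : ∀ D x y → x * x ≡ (x * x - D * (y * y)) + D * (y * y)
  rearrange = solve 3 (λ D x y → x :* x := (x :* x :- D :* (y :* y)) :+ D :* (y :* y)) refl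
  Dy²≤0 : ⟦ D ⟧ * (y * y) ≤ 0ℚ
  Dy²≤0 = ℚP.nonPositive⁻¹ _ {{ℚP.nonPos*nonNeg⇒nonPos ⟦ D ⟧ {{D≤0}} (y * y) {{*-self-nonNeg y}}}}
    where
    D≤0 : ℚ.NonPositive ⟦ D ⟧
    D≤0 = ℚ.nonPositive (⟦⟧-mono-≤ (ℤP.<⇒≤ D<0))

bernoulli : ∀ {δ} → 0ℚ ≤ δ → ∀ m → 1ℚ + ⟦ + m ⟧ * δ ≤ (1ℚ + δ) ^ℚ m
bernoulli {δ} 0≤δ zero = ℚP.≤-reflexive (begin-equality
  1ℚ + 0ℚ * δ  ≡⟨ cong (λ q → 1ℚ + q) (ℚP.*-zeroˡ δ) ⟩
  1ℚ + 0ℚ      ≡⟨ ℚP.+-identityʳ 1ℚ ⟩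
  1ℚ           ∎)
  where open ℚP.≤-Reasoning
bernoulli {δ} 0≤δ (suc m) = begin
  1ℚ + ⟦ + suc m ⟧ * δ                      ≡⟨ cong (λ c → 1ℚ + c * δ) (⟦⟧-+ (+ 1) (+ m)) ⟩
  1ℚ + (1ℚ + c) * δ                         ≡⟨ ℚP.+-identityʳ (1ℚ + (1ℚ + c) * δ) ⟨
  1ℚ + (1ℚ + c) * δ + 0ℚ                    ≤⟨ ℚP.+-monoʳ-≤ (1ℚ + (1ℚ + c) * δ) 0≤cδ² ⟩
  1ℚ + (1ℚ + c) * δ + c * δ * δ             ≡⟨ factor c δ ⟩
  (1ℚ + δ) * (1ℚ + c * δ)                   ≤⟨ ℚP.*-monoˡ-≤-nonNeg (1ℚ + δ) (bernoulli 0≤δ m) ⟩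
  (1ℚ + δ) * (1ℚ + δ) ^ℚ m                  ∎
  where
  open ℚP.≤-Reasoning
  open ℚSolver.+-*-Solver using (solve; con; _:+_; _:*_; _:=_)
  c : ℚ
  c = ⟦ + m ⟧
  instance
    δ≥0 : ℚ.NonNegative δ
    δ≥0 = ℚ.nonNegative 0≤δ
    c≥0 : ℚ.NonNegative c
    c≥0 = ℚ.nonNegative (⟦⟧-mono-≤ (ℤ.+≤+ (ℕ.z≤n {m})))
    1+δ≥0 : ℚ.NonNegative (1ℚ + δ)
    1+δ≥0 = ℚP.nonNeg+nonNeg⇒nonNeg 1ℚ δ
  0≤cδ² : 0ℚ ≤ c * δ * δ
  0≤cδ² = ℚP.nonNegative⁻¹ (c * δ * δ)
    {{ℚP.nonNeg*nonNeg⇒nonNeg (c * δ) {{ℚP.nonNeg*nonNeg⇒nonNeg c δ}} δ}}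
  factor : ∀ c δ → 1ℚ + (1ℚ + c) * δ + c * δ * δ ≡ (1ℚ + δ) * (1ℚ + c * δ)
  factor = solve 2 (λ c δ →
    con 1ℚ :+ (con 1ℚ :+ c) :* δ :+ c :* δ :* δ := (con 1ℚ :+ δ) :* (con 1ℚ :+ c :* δ)) refl

2≤[1+δ]^m : ∀ {δ} → 0ℚ < δ → ∀ {m} → ↧ₙ δ ℕ.≤ m → ⟦ + 2 ⟧ ≤ (1ℚ + δ) ^ℚ m
2≤[1+δ]^m {δ@(ℚ.mkℚ _ _ _)} 0<δ {m} ↧ₙδ≤m = begin
  1ℚ + 1ℚ                  ≤⟨ ℚP.+-monoʳ-≤ 1ℚ 1≤mδ ⟩
  1ℚ + ⟦ + m ⟧ * δ         ≤⟨ bernoulli (ℚP.<⇒≤ 0<δ) m ⟩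
  (1ℚ + δ) ^ℚ m            ∎
  where
  open ℚP.≤-Reasoning
  1≤mδ : 1ℚ ≤ ⟦ + m ⟧ * δ
  1≤mδ = begin
    1ℚ                 ≤⟨ ⟦⟧-mono-≤ (ℤP.i<j⇒suc[i]≤j (ℤP.positive⁻¹ (↥ δ) {{ℚ.positive 0<δ}})) ⟩
    ⟦ ↥ δ ⟧            ≡⟨ ⟦↧p⟧*p≡⟦↥p⟧ δ ⟨
    ⟦ ↧ δ ⟧ * δ        ≤⟨ ℚP.*-monoʳ-≤-nonNeg δ {{ℚ.nonNegative (ℚP.<⇒≤ 0<δ)}}
                            (⟦⟧-mono-≤ (ℤ.+≤+ ↧ₙδ≤m)) ⟩
    ⟦ + m ⟧ * δ        ∎

n≤2^n : ∀ n → n ℕ.≤ 2 ^ n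
n≤2^n zero    = ℕ.z≤n
n≤2^n (suc n) = ℕP.+-mono-≤ (ℕP.m^n>0 2 n) (ℕP.≤-trans (n≤2^n n) (ℕP.m≤m+n (2 ^ n) 0))

within-2⇒within : ∀ {A : ℚ} {m n} → ⟦ + 2 ⟧ ≤ A → m ℕ.≤ n → n ℕ.≤ 2 ℕ.* m →
                   (⟦ + m ⟧ ≤ A * ⟦ + n ⟧) × (⟦ + n ⟧ ≤ A * ⟦ + m ⟧)
within-2⇒within {A} {m} {n} 2≤A m≤n n≤2m = m≤An , n≤Am
  where
  open ℚP.≤-Reasoning
  ⟦⟧≥0 : ∀ k → ℚ.NonNegative ⟦ + k ⟧
  ⟦⟧≥0 k = ℚ.nonNegative (⟦⟧-mono-≤ (ℤ.+≤+ (ℕ.z≤n {k})))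
  m≤An : ⟦ + m ⟧ ≤ A * ⟦ + n ⟧
  m≤An = begin
    ⟦ + m ⟧            ≤⟨ ⟦⟧-mono-≤ (ℤ.+≤+ m≤n) ⟩
    ⟦ + n ⟧            ≡⟨ ℚP.*-identityˡ ⟦ + n ⟧ ⟨
    1ℚ * ⟦ + n ⟧       ≤⟨ ℚP.*-monoʳ-≤-nonNeg ⟦ + n ⟧ {{⟦⟧≥0 n}}
                            (ℚP.≤-trans (⟦⟧-mono-≤ {+ 1} {+ 2} (ℤ.+≤+ (ℕ.s≤s ℕ.z≤n))) 2≤A) ⟩
    A * ⟦ + n ⟧        ∎
  n≤Am : ⟦ + n ⟧ ≤ A * ⟦ + m ⟧
  n≤Am = begin
    ⟦ + n ⟧            ≤⟨ ⟦⟧-mono-≤ (ℤ.+≤+ n≤2m) ⟩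
    ⟦ + (2 ℕ.* m) ⟧    ≡⟨ trans (cong ⟦_⟧ (ℤP.pos-* 2 m)) (⟦⟧-* (+ 2) (+ m)) ⟩
    ⟦ + 2 ⟧ * ⟦ + m ⟧  ≤⟨ ℚP.*-monoʳ-≤-nonNeg ⟦ + m ⟧ {{⟦⟧≥0 m}} 2≤A ⟩
    A * ⟦ + m ⟧        ∎

proposition4p11 : (d : ℤ) → SquareFree d → d ≢ + 1 → Δ d ℤ.< + 0 →
    (x y : ℚ) → x * x - ⟦ Δ d ⟧ * (y * y) ≡ ⟦ + 4 ⟧ →
    (r s : ℤ) (n : ℕ) .{{_ : ℕ.NonZero n}} →
    x ≡ r / n → y ≡ s / n → gcd ℤ.∣ r ∣ n ≡ 1 → gcd ℤ.∣ s ∣ n ≡ 1 →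
    -- h(P) = lim 2^(-k) log H(x(2^k P)) = log n, unfolded:
    -- ∀ δ>0 ∃K ∀k≥K, n^(2^k) ≤ (1+δ)^(2^k) H_k  and  H_k ≤ (1+δ)^(2^k) n^(2^k)
    (δ : ℚ) → ℚ.0ℚ < δ →
    ∃ λ (K : ℕ) → (k : ℕ) → k ≥ K →
      (⟦ + (n ^ (2 ^ k)) ⟧ ≤ ((ℚ.1ℚ + δ) ^ℚ (2 ^ k)) * ⟦ + H (proj₁ (pow2C (Δ d) k (x , y))) ⟧)
      × (⟦ + H (proj₁ (pow2C (Δ d) k (x , y))) ⟧ ≤ ((ℚ.1ℚ + δ) ^ℚ (2 ^ k)) * ⟦ + (n ^ (2 ^ k)) ⟧)
proposition4p11 d _ _ Δ<0 x y P∈C r _ n x≡r/n _ r⊥n _ δ 0<δ = ↧ₙ δ , λ k k≥K →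
  subst (λ N → (⟦ + N ⟧ ≤ A k * ⟦ + H (xₖ k) ⟧) × (⟦ + H (xₖ k) ⟧ ≤ A k * ⟦ + N ⟧))
    (↧ₙxₖ≡n^2^k k)
    (within-2⇒within (2≤[1+δ]^m 0<δ (ℕP.≤-trans k≥K (n≤2^n k)))
      (ℕP.m≤n⊔m ℤ.∣ ↥ xₖ k ∣ (↧ₙ xₖ k))
      (H≤2↧ₙ (xₖ k) (onCurve⇒x*x≤4 Δ<0 {2ᵏP k} (pow2C-onCurve (Δ d) {P} P∈C k))))
  where
  P : ℚ × ℚ
  P = (x , y)
  2ᵏP : ℕ → ℚ × ℚ
  2ᵏP k = pow2C (Δ d) k P
  xₖ : ℕ → ℚ
  xₖ k = proj₁ (2ᵏP k)
  A : ℕ → ℚ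
  A k = (1ℚ + δ) ^ℚ (2 ^ k)
  ↧ₙxₖ≡n^2^k : ∀ k → ↧ₙ xₖ k ≡ n ^ (2 ^ k)
  ↧ₙxₖ≡n^2^k k = trans (↧ₙ-pow2C (Δ d) {P} P∈C k)
    (cong (_^ (2 ^ k)) (trans (cong ↧ₙ_ x≡r/n) (↧ₙ-/ r n (ℕC.gcd≡1⇒coprime r⊥n))))
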